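{- Let $G$ be a finite $2$-connected graph and let $u,v$ be two vertices of $G$ such that $G-u-v$ is the disjoint union of two nonempty graphs $G_1$ and $G_2$ (i.e. $V(G)\setminus\{u,v\}=V(G_1)\cup V(G_2)$ with no edges of $G$ between $V(G_1)$ and $V(G_2)$). If $d(w)\geq\delta$ for every vertex $w\neq u,v$ of $G$, then there is a path in $G$ joining $u$ to $v$ of order at least $\delta+1$ that has no vertices in common with $G_1$.
   Context: The order of a path is its number of vertices. $d(w)$ denotes the degree of $w$ in $G$. -}

module Defs where

open import Data.Nat using (ℕ; _≤_)
open import Data.Fin using (Fin)
open import Data.Bool using (Bool; true; false)
open import Data.List using (List; []; _∷_; length; filter)
open import Data.List.Relation.Unary.All using (All)
open import Data.List.Relation.Unary.Unique.Propositional using (Unique)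
open import Data.Product using (Σ; ∃; _×_)
open import Data.Fin.Subset using (Subset)
open import Relation.Binary.PropositionalEquality using (_≡_; _≢_)
open import Relation.Nullary using (¬_)
open import Data.Bool using (T)
open import Data.List using (allFin)
open import Relation.Nullary.Decidable using (Dec)
open import Data.Bool.Properties using (T?)

record Graph : Set where
  field
    n     : ℕ
    adj   : Fin n → Fin n → Bool
    sym   : ∀ x y → adj x y ≡ adj y x
    loopless : ∀ x → adj x x ≡ false
open Graph public

Adj : (G : Graph) → Fin (n G) → Fin (n G) → Set
Adj G x y = adj G x y ≡ true

degree : (G : Graph) → Fin (n G) → ℕ
degree G w = length (filter (λ x → T? (adj G w x)) (allFin (n G)))

data Walk (G : Graph) : Fin (n G) → Fin (n G) → List (Fin (n G)) → Set where
  here : ∀ {a} → Walk G a a (a ∷ [])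
  step : ∀ {a b c xs} → Adj G a b → Walk G b c xs → Walk G a c (a ∷ xs)

-- A path from a to b: a walk with pairwise distinct vertices; its order is length xs.
Path : (G : Graph) → Fin (n G) → Fin (n G) → List (Fin (n G)) → Set
Path G a b xs = Walk G a b xs × Unique xs

ConnectedOn : (G : Graph) → (Fin (n G) → Set) → Set
ConnectedOn G S = ∀ a b → S a → S b → ∃ λ xs → Walk G a b xs × All S xs

TwoConnected : Graph → Set
TwoConnected G = (3 ≤ n G) × (∀ x → ConnectedOn G (λ y → y ≢ x))

module Submission where

-- Call a nonempty vertex set S with two distinct outside vertices u, v a lobe if every x ∈ S has
-- at least δ neighbours in S ∪ {u, v} and, for every vertex c ≠ x, x still reaches u or v inside
-- (S ∪ {u, v}) − c. Every lobe carries a u–v path of order > δ through S, by induction on |S|.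
-- Pick a neighbour z ∈ S of u and let S′ = S − z. If S′ = ∅ then δ ≤ 2 and u z v will do. If S′ is
-- a lobe for z, v and δ − 1 (a vertex of S′ loses at most the neighbour u), prepend u to its path.
-- Otherwise some x ∈ S′ is cut off from {z, v} by a vertex c. The set D of all such x has all its
-- neighbours in D ∪ {u, c}, so D is a lobe for u, c and the same δ; its u–c path continues along a
-- c–v path in S ∪ {v} avoiding u, which by this closure never enters D.
-- In the theorem, S = V(G₂) is a lobe for u, v by 2-connectivity.

open import Defs
open import Data.Nat using (ℕ; _≤_; suc)
open import Data.Fin using (Fin)
open import Data.Fin.Subset using (Subset; _∈_; _∉_)
open import Data.List using (List; length)
open import Data.List.Relation.Unary.All using (All)
open import Data.Product using (Σ; ∃; _×_)
open import Data.Sum using (_⊎_)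
open import Relation.Binary.PropositionalEquality using (_≡_; _≢_)
open import Relation.Nullary using (¬_)

open import Data.Bool using (true)
import Data.Bool as Bool
open import Data.Bool.Properties using (T?; T-≡)
open import Data.Empty using (⊥; ⊥-elim)
open import Data.Fin using (_≟_)
open import Data.Fin.Properties using (any?)
open import Data.Fin.Subset.Properties using (_∈?_)
open import Data.List using ([]; _∷_; _++_; filter; allFin)
open import Data.List.Properties using (filter-notAll; filter-some; length-++-≤ˡ; length-tabulate)
import Data.List.Membership.Propositional as List
open import Data.List.Membership.Propositional.Properties using (∈-filter⁺; ∈-filter⁻; ∈-allFin)
open import Data.List.Relation.Binary.Pointwise using (Pointwise-≡⇒≡)
open import Data.List.Relation.Binary.Sublist.Propositional using (⊆-refl) renaming (_⊆_ to Sublist)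
open import Data.List.Relation.Binary.Sublist.Propositional.Properties using (filter⁺; length-mono-≤; to-≋)
open import Data.List.Relation.Unary.All using ([]; _∷_)
import Data.List.Relation.Unary.All as All
open import Data.List.Relation.Unary.All.Properties using (¬Any⇒All¬)
import Data.List.Relation.Unary.All.Properties as All
open import Data.List.Relation.Unary.Any using (here; there)
import Data.List.Relation.Unary.Any as Any
open import Data.List.Relation.Unary.Unique.Propositional using (Unique; []; _∷_)
import Data.List.Relation.Unary.Unique.Propositional.Properties as Unique
open import Data.Nat using (zero; _+_; _∸_; _<_; z≤n; s≤s)
open import Data.Nat.Properties
  using ( ≤-refl; ≤-trans; ≤-reflexive; ≤-pred; ≤∧≢⇒<; n≤1+n; m≤n⇒m≤1+n
        ; +-suc; +-monoˡ-≤; +-monoʳ-≤; +-mono-≤; m≤n+o⇒m∸n≤o; m≤n+m∸n; module ≤-Reasoning)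
open import Data.Product using (_,_; proj₁; proj₂)
open import Data.Sum using (inj₁; inj₂; [_,_])
import Data.Sum as Sum
open import Function using (_∘_; id; Equivalence)
open import Level using (0ℓ)
open import Relation.Binary using (DecidableEquality)
open import Relation.Binary.PropositionalEquality using (refl; subst)
import Relation.Binary.PropositionalEquality as ≡
open import Relation.Nullary using (Dec; yes; no; ¬?)
open import Relation.Nullary.Decidable using (_×-dec_; _⊎-dec_; decidable-stable)
open import Relation.Unary using (Pred; Decidable; _∪_; _∩_; _∖_; ∁; ｛_｝) renaming (_⊆_ to _⊆ₚ_)
open import Relation.Unary.Properties using (_∪?_; _∩?_; ∁?)

module _ {A : Set} where

  count : {P : Pred A 0ℓ} → Decidable P → List A → ℕ
  count P? xs = length (filter P? xs)

  count-mono : {P Q : Pred A 0ℓ} (P? : Decidable P) (Q? : Decidable Q) →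
               P ⊆ₚ Q → ∀ xs → count P? xs ≤ count Q? xs
  count-mono P? Q? P⊆Q xs = length-mono-≤ (filter⁺ P? Q? (λ { refl → P⊆Q }) (⊆-refl {x = xs}))

  count-< : {P Q : Pred A 0ℓ} (P? : Decidable P) (Q? : Decidable Q) →
            P ⊆ₚ Q → ∀ {z xs} → Q z → ¬ P z → z List.∈ xs → count P? xs < count Q? xs
  count-< P? Q? P⊆Q {z} {xs} qz ¬pz z∈xs = ≤∧≢⇒< (length-mono-≤ sub) counts-differ
    where
    sub : Sublist (filter P? xs) (filter Q? xs)
    sub = filter⁺ P? Q? (λ { refl → P⊆Q }) (⊆-refl {x = xs})

    counts-differ : count P? xs ≢ count Q? xs
    counts-differ eq = ¬pz (proj₂ (∈-filter⁻ P? {xs = xs}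
      (subst (z List.∈_) (≡.sym (Pointwise-≡⇒≡ (to-≋ eq sub))) (∈-filter⁺ Q? z∈xs qz))))

  count-∪ : {P Q : Pred A 0ℓ} (P? : Decidable P) (Q? : Decidable Q) →
            ∀ xs → count (P? ∪? Q?) xs ≤ count P? xs + count Q? xs
  count-∪ P? Q? [] = z≤n
  count-∪ P? Q? (x ∷ xs) with P? x | Q? x
  ... | yes _ | yes _ = s≤s (≤-trans (count-∪ P? Q? xs) (+-monoʳ-≤ (count P? xs) (n≤1+n _)))
  ... | yes _ | no _  = s≤s (count-∪ P? Q? xs)
  ... | no _  | yes _ = ≤-trans (s≤s (count-∪ P? Q? xs)) (≤-reflexive (≡.sym (+-suc _ _)))
  ... | no _  | no _  = count-∪ P? Q? xs

module _ {A : Set} (_≟ᴬ_ : DecidableEquality A) where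

  unique-length-≤ : ∀ {xs : List A} → Unique xs → ∀ ys →
                    (∀ {x} → x List.∈ xs → x List.∈ ys) → length xs ≤ length ys
  unique-length-≤ [] ys _ = z≤n
  unique-length-≤ {x ∷ xs} (x∉xs ∷ u) ys xs⊆ys =
    ≤-trans (s≤s (unique-length-≤ u ys′ xs⊆ys′))
            (filter-notAll (¬? ∘ (x ≟ᴬ_)) ys (Any.map (λ { refl x≢x → x≢x refl }) (xs⊆ys (here refl))))
    where
    ys′ : List A
    ys′ = filter (¬? ∘ (x ≟ᴬ_)) ys

    xs⊆ys′ : ∀ {y} → y List.∈ xs → y List.∈ ys′
    xs⊆ys′ y∈xs = ∈-filter⁺ (¬? ∘ (x ≟ᴬ_)) (xs⊆ys (there y∈xs)) (All.lookup x∉xs y∈xs)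

  count-singleton : ∀ a {xs} → Unique xs → count (a ≟ᴬ_) xs ≤ 1
  count-singleton a {xs} u = unique-length-≤ (Unique.filter⁺ (a ≟ᴬ_) u) (a ∷ [])
    (λ m → here (≡.sym (proj₂ (∈-filter⁻ (a ≟ᴬ_) {xs = xs} m))))

module _ (G : Graph) where
  private
    V : Set
    V = Fin (n G)

    vertices : List V
    vertices = allFin (n G)

    variable
      P Q : Pred V 0ℓ
      a b c w x y : V
      xs ys ws : List V
      δ : ℕ

  Adj? : ∀ x → Decidable (Adj G x)
  Adj? x y = adj G x y Bool.≟ true

  Adj-sym : Adj G x y → Adj G y x
  Adj-sym {x = x} {y = y} = ≡.trans (Graph.sym G y x)

  Adj-irrefl : ¬ Adj G x x
  Adj-irrefl {x = x} e with ≡.trans (≡.sym (loopless G x)) e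
  ... | ()

  degreeIn : Decidable P → V → ℕ
  degreeIn P? x = count (Adj? x ∩? P?) vertices

  vertex-count≤1 : ∀ a → count (a ≟_) vertices ≤ 1
  vertex-count≤1 a = count-singleton _≟_ a (Unique.allFin⁺ (n G))

  Reach : Pred V 0ℓ → V → V → Set
  Reach P x y = ∃ λ ws → Walk G x y ws × All P ws

  Attach : Pred V 0ℓ → V → V → Pred V 0ℓ
  Attach S u v = S ∪ ｛ u ｝ ∪ ｛ v ｝

  attach? : {S : Pred V 0ℓ} → Decidable S → ∀ u v → Decidable (Attach S u v)
  attach? S? u v = S? ∪? (u ≟_) ∪? (v ≟_)

  walk-++ : Walk G a b xs → Walk G b c (b ∷ ys) → Walk G a c (xs ++ ys)
  walk-++ here w = w
  walk-++ (step e w) w′ = step e (walk-++ w w′)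

  walk-head : Walk G a b xs → All P xs → P a
  walk-head here (p ∷ _) = p
  walk-head (step _ _) (p ∷ _) = p

  walk-last : Walk G a b xs → All P xs → P b
  walk-last here (p ∷ _) = p
  walk-last (step _ w) (_ ∷ ps) = walk-last w ps

  path-suffix : Path G b c xs → All P xs → a List.∈ xs →
                ∃ λ ys → Path G a c ys × All P ys
  path-suffix (here , u) ps (here refl) = _ , (here , u) , ps
  path-suffix (step e w , u) ps (here refl) = _ , (step e w , u) , ps
  path-suffix (step _ w , _ ∷ u) (_ ∷ ps) (there a∈xs) = path-suffix (w , u) ps a∈xs

  walk⇒path : Walk G a b ws → All P ws → ∃ λ xs → Path G a b xs × All P xs
  walk⇒path here ps = _ , (here , [] ∷ []) , ps
  walk⇒path {a = a} (step e w) (p ∷ ps) with walk⇒path w ps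
  ... | xs , (w′ , u) , ps′ with Any.any? (a ≟_) xs
  ...   | yes a∈xs = path-suffix (w′ , u) ps′ a∈xs
  ...   | no a∉xs = a ∷ xs , (step e w′ , ¬Any⇒All¬ xs a∉xs ∷ u) , p ∷ ps′

  reach-map : P ⊆ₚ Q → Reach P x y → Reach Q x y
  reach-map P⊆Q (ws , w , ps) = ws , w , All.map P⊆Q ps

  path-++ : Path G a b xs → Path G b c (b ∷ ys) →
            (∀ {w} → w List.∈ xs → w List.∈ ys → ⊥) → Path G a c (xs ++ ys)
  path-++ (w , u) (w′ , _ ∷ u′) disjoint = walk-++ w w′ , Unique.++⁺ u u′ λ (p , q) → disjoint p q

  walk-avoids : (∀ {d e} → Q d → Adj G d e → P e → Q e) →
                Walk G a b ws → All P ws → ¬ Q b → All (∁ Q) ws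
  walk-avoids closed here _ ¬qb = ¬qb ∷ []
  walk-avoids closed (step e w) (_ ∷ ps) ¬qb with walk-avoids closed w ps ¬qb
  ... | ¬qs = (λ qa → walk-head w ¬qs (closed qa e (walk-head w ps))) ∷ ¬qs

  walk-exit : ∀ {D : Pred V 0ℓ} → Decidable D → Walk G x y ws → All P ws → D x → ¬ D y →
              ∃ λ d → ∃ λ e → D d × Adj G d e × ¬ D e × Reach (P ∩ (D ∪ ｛ e ｝)) x e
  walk-exit D? here _ dx ¬dy = ⊥-elim (¬dy dx)
  walk-exit {x = x} D? (step {b = b} e w) (px ∷ ps) dx ¬dy with D? b
  ... | no ¬db = x , b , dx , e , ¬db , _ , step e here , (px , inj₁ dx) ∷ (walk-head w ps , inj₂ refl) ∷ []
  ... | yes db with walk-exit D? w ps db ¬dy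
  ...   | d , e′ , dd , de′ , ¬de′ , vs , w′ , ps′ =
          d , e′ , dd , de′ , ¬de′ , x ∷ vs , step e w′ , (px , inj₁ dx) ∷ ps′

  path-length≤ : Path G a b xs → length xs ≤ n G
  path-length≤ (_ , u) = ≤-trans (unique-length-≤ _≟_ u vertices (λ {x} _ → ∈-allFin x))
                                 (≤-reflexive (length-tabulate id))

  module _ (P? : Decidable P) (y : V) where
    private
      ReachIn : ℕ → V → Set
      ReachIn zero x = P x × x ≡ y
      ReachIn (suc k) x = P x × (x ≡ y ⊎ ∃ λ b → Adj G x b × ReachIn k b)

      reachIn? : ∀ k x → Dec (ReachIn k x)
      reachIn? zero x = P? x ×-dec x ≟ y
      reachIn? (suc k) x = P? x ×-dec (x ≟ y ⊎-dec any? (λ b → Adj? x b ×-dec reachIn? k b))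

      sound : ∀ k {x} → ReachIn k x → Reach P x y
      sound zero (p , refl) = _ , here , p ∷ []
      sound (suc k) (p , inj₁ refl) = _ , here , p ∷ []
      sound (suc k) (p , inj₂ (b , e , r)) with sound k r
      ... | ws , w , ps = _ , step e w , p ∷ ps

      complete : ∀ k {x ws} → Walk G x y ws → All P ws → length ws ≤ suc k → ReachIn k x
      complete zero here (p ∷ []) _ = p , refl
      complete (suc k) here (p ∷ []) _ = p , inj₁ refl
      complete zero (step e here) _ (s≤s ())
      complete zero (step e (step _ _)) _ (s≤s ())
      complete (suc k) (step e w) (p ∷ ps) (s≤s le) = p , inj₂ (_ , e , complete k w ps le)

    -- A path has at most n G vertices, so a bounded search decides reachability.
    reach? : ∀ x → Dec (Reach P x y)
    reach? x with reachIn? (n G) x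
    ... | yes r = yes (sound (n G) r)
    ... | no ¬r = no λ (_ , w , ps) → let (xs , path , ps′) = walk⇒path w ps in
                   ¬r (complete (n G) (proj₁ path) ps′ (m≤n⇒m≤1+n (path-length≤ path)))

  reach-boundary : Decidable Q →
    (∀ {d e} → Q d → Adj G d e → P e → ¬ Q e → a ≡ e ⊎ b ≡ e) →
    Q x → ¬ Q y → Reach P x y → Reach (Attach Q a b ∩ P) x a ⊎ Reach (Attach Q a b ∩ P) x b
  reach-boundary Q? boundary qx ¬qy (_ , w , ps) with walk-exit Q? w ps qx ¬qy
  ... | d , e , qd , de , ¬qe , vs , w′ , ps′ with boundary qd de (proj₁ (walk-last w′ ps′)) ¬qe
  ...   | inj₁ refl = inj₁ (vs , w′ , All.map (λ (p , q) → [ inj₁ , inj₂ ∘ inj₁ ] q , p) ps′)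
  ...   | inj₂ refl = inj₂ (vs , w′ , All.map (λ (p , q) → [ inj₁ , inj₂ ∘ inj₂ ] q , p) ps′)

  attach-⊆ : ∀ {S T : Pred V 0ℓ} {u v u′ v′} → S ⊆ₚ Attach T u′ v′ →
             Attach T u′ v′ u → Attach T u′ v′ v → Attach S u v ⊆ₚ Attach T u′ v′
  attach-⊆ S⊆T _ _ (inj₁ s) = S⊆T s
  attach-⊆ _ u∈T _ (inj₂ (inj₁ refl)) = u∈T
  attach-⊆ _ _ v∈T (inj₂ (inj₂ refl)) = v∈T

  Linked : Pred V 0ℓ → V → V → Set
  Linked S u v = ∀ {c x} → S x → c ≢ x →
                 Reach (Attach S u v ∖ ｛ c ｝) x u ⊎ Reach (Attach S u v ∖ ｛ c ｝) x v

  record Lobe {S : Pred V 0ℓ} (S? : Decidable S) (u v : V) (δ : ℕ) : Set where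
    field
      u≢v : u ≢ v
      u∉S : ¬ S u
      v∉S : ¬ S v
      inhabited : ∃ S
      min-degree : ∀ {x} → S x → δ ≤ degreeIn (attach? S? u v) x
      linked : Linked S u v

  LongPath : Pred V 0ℓ → V → V → ℕ → Set
  LongPath S u v δ = ∃ λ xs → Path G u v xs × suc δ ≤ length xs × All (Attach S u v) xs

  module InductionStep (k : ℕ)
      (ih : ∀ {S : Pred V 0ℓ} {S? : Decidable S} {u v δ} →
            count S? vertices ≤ k → Lobe S? u v δ → LongPath S u v δ)
      {S : Pred V 0ℓ} (S? : Decidable S) {u v : V} {δ : ℕ}
      (size : count S? vertices ≤ suc k) (L : Lobe S? u v δ) where
    open Lobe L

    reaches-v : S x → Reach (Attach S u v ∖ ｛ u ｝) x v
    reaches-v sx with linked {c = u} sx (λ u≡x → u∉S (subst S (≡.sym u≡x) sx))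
    ... | inj₁ (_ , w , ps) = ⊥-elim (proj₂ (walk-last w ps) refl)
    ... | inj₂ r = r

    neighbour-of-u : ∃ λ z → S z × Adj G u z
    neighbour-of-u with inhabited
    ... | x₀ , sx₀ with linked {c = v} sx₀ (λ v≡x → v∉S (subst S (≡.sym v≡x) sx₀))
    ...   | inj₂ (_ , w , ps) = ⊥-elim (proj₂ (walk-last w ps) refl)
    ...   | inj₁ (_ , w , ps) with walk-exit S? w ps sx₀ u∉S
    ...     | d , e , sd , de , ¬se , _ , w′ , ps′ with walk-last w′ ps′
    ...       | (inj₁ se , _) , _ = ⊥-elim (¬se se)
    ...       | (inj₂ (inj₁ refl) , _) , _ = d , sd , Adj-sym de
    ...       | (inj₂ (inj₂ refl) , v≢v) , _ = ⊥-elim (v≢v refl)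

    module Peel {z : V} (sz : S z) (uz : Adj G u z) where

      S′ : Pred V 0ℓ
      S′ = S ∖ ｛ z ｝

      S′? : Decidable S′
      S′? = S? ∩? ∁? (z ≟_)

      u≢z : u ≢ z
      u≢z refl = u∉S sz

      z≢v : z ≢ v
      z≢v refl = v∉S sz

      S⊆Attach′ : S ⊆ₚ Attach S′ z v
      S⊆Attach′ {w} sw with z ≟ w
      ... | yes z≡w = inj₂ (inj₁ z≡w)
      ... | no z≢w = inj₁ (sw , z≢w)

      u∉Attach′ : ¬ Attach S′ z v u
      u∉Attach′ (inj₁ (su , _)) = u∉S su
      u∉Attach′ (inj₂ (inj₁ z≡u)) = u≢z (≡.sym z≡u)
      u∉Attach′ (inj₂ (inj₂ v≡u)) = u≢v (≡.sym v≡u)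

      size′ : count S′? vertices ≤ k
      size′ = ≤-pred (≤-trans (count-< S′? S? proj₁ sz (λ s′z → proj₂ s′z refl) (∈-allFin z)) size)

      path-through-z : (∀ {w} → S w → z ≡ w) → LongPath S u v δ
      path-through-z only =
        u ∷ z ∷ v ∷ [] ,
        (step uz (step zv here) , (u≢z ∷ u≢v ∷ []) ∷ (z≢v ∷ []) ∷ [] ∷ []) ,
        s≤s δ≤2 ,
        inj₂ (inj₁ refl) ∷ inj₁ sz ∷ inj₂ (inj₂ refl) ∷ []
        where
        no-loop : S y → ¬ Adj G z y
        no-loop sy zy = Adj-irrefl (subst (Adj G z) (≡.sym (only sy)) zy)

        zv : Adj G z v
        zv with reaches-v sz
        ... | _ , here , _ = ⊥-elim (v∉S sz)
        ... | _ , step zb w , _ ∷ ps with walk-head w ps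
        ...   | inj₁ sb , _ = ⊥-elim (no-loop sb zb)
        ...   | inj₂ (inj₁ u≡b) , u≢b = ⊥-elim (u≢b u≡b)
        ...   | inj₂ (inj₂ refl) , _ = zb

        neighbours : Adj G z ∩ Attach S u v ⊆ₚ ｛ u ｝ ∪ ｛ v ｝
        neighbours (zw , inj₁ sw) = ⊥-elim (no-loop sw zw)
        neighbours (_ , inj₂ uv) = uv

        δ≤2 : δ ≤ 2
        δ≤2 = begin
          δ                                             ≤⟨ min-degree sz ⟩
          degreeIn (attach? S? u v) z                   ≤⟨ count-mono _ ((u ≟_) ∪? (v ≟_)) neighbours vertices ⟩
          count ((u ≟_) ∪? (v ≟_)) vertices             ≤⟨ count-∪ (u ≟_) (v ≟_) vertices ⟩
          count (u ≟_) vertices + count (v ≟_) vertices ≤⟨ +-mono-≤ (vertex-count≤1 u) (vertex-count≤1 v) ⟩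
          2                                             ∎
          where open ≤-Reasoning

      shifted-lobe : ∃ S′ → Linked S′ z v → Lobe S′? z v (δ ∸ 1)
      shifted-lobe inhabited′ linked′ = record
        { u≢v = z≢v ; u∉S = λ s′z → proj₂ s′z refl ; v∉S = v∉S ∘ proj₁
        ; inhabited = inhabited′ ; min-degree = min-degree′ ; linked = linked′ }
        where
        reattach : Adj G x ∩ Attach S u v ⊆ₚ ｛ u ｝ ∪ (Adj G x ∩ Attach S′ z v)
        reattach (xw , inj₁ sw) = inj₂ (xw , S⊆Attach′ sw)
        reattach (_ , inj₂ (inj₁ u≡w)) = inj₁ u≡w
        reattach (xw , inj₂ (inj₂ v≡w)) = inj₂ (xw , inj₂ (inj₂ v≡w))

        min-degree′ : S′ x → δ ∸ 1 ≤ degreeIn (attach? S′? z v) x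
        min-degree′ {x} s′x = m≤n+o⇒m∸n≤o δ 1 (begin
          δ                                      ≤⟨ min-degree (proj₁ s′x) ⟩
          degreeIn (attach? S? u v) x            ≤⟨ count-mono _ ((u ≟_) ∪? neighbour′?) reattach vertices ⟩
          count ((u ≟_) ∪? neighbour′?) vertices ≤⟨ count-∪ (u ≟_) neighbour′? vertices ⟩
          count (u ≟_) vertices + count neighbour′? vertices ≤⟨ +-monoˡ-≤ _ (vertex-count≤1 u) ⟩
          1 + degreeIn (attach? S′? z v) x       ∎)
          where
          open ≤-Reasoning
          neighbour′? : Decidable (Adj G x ∩ Attach S′ z v)
          neighbour′? = Adj? x ∩? attach? S′? z v

      extend : LongPath S′ z v (δ ∸ 1) → LongPath S u v δ
      extend (xs , (w , uq) , len , ps) =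
        u ∷ xs ,
        (step uz w , All.map (λ aw u≡w → u∉Attach′ (subst (Attach S′ z v) (≡.sym u≡w) aw)) ps ∷ uq) ,
        s≤s (≤-trans (m≤n+m∸n δ 1) len) ,
        inj₂ (inj₁ refl) ∷ All.map (attach-⊆ {S = S′} (inj₁ ∘ proj₁) (inj₁ sz) (inj₂ (inj₂ refl))) ps

      Escapes : V → V → Set
      Escapes c y = Reach (Attach S′ z v ∖ ｛ c ｝) y z ⊎ Reach (Attach S′ z v ∖ ｛ c ｝) y v

      Trapped : V → Pred V 0ℓ
      Trapped c y = S′ y × c ≢ y × ¬ Escapes c y

      escapes? : ∀ c y → Dec (Escapes c y)
      escapes? c y = reach? avoid-c? z y ⊎-dec reach? avoid-c? v y
        where
        avoid-c? : Decidable (Attach S′ z v ∖ ｛ c ｝)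
        avoid-c? = attach? S′? z v ∩? ∁? (c ≟_)

      trapped? : ∀ c → Decidable (Trapped c)
      trapped? c y = S′? y ×-dec ¬? (c ≟ y) ×-dec ¬? (escapes? c y)

      linked-or-trapped : Linked S′ z v ⊎ ∃ λ c → ∃ (Trapped c)
      linked-or-trapped with any? (λ c → any? (trapped? c))
      ... | yes trapped = inj₂ trapped
      ... | no ¬trapped = inj₁ λ {c} {x} s′x c≢x →
        decidable-stable (escapes? c x) (λ ¬esc → ¬trapped (c , x , s′x , c≢x , ¬esc))

      module Cut {c x : V} (trapped : Trapped c x) where

        D : Pred V 0ℓ
        D = Trapped c

        D⊆S : D ⊆ₚ S
        D⊆S = proj₁ ∘ proj₁

        size-D : count (trapped? c) vertices ≤ k
        size-D = ≤-pred (≤-trans (count-< (trapped? c) S? D⊆S sz z∉D (∈-allFin z)) size)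
          where
          z∉D : ¬ D z
          z∉D dz = proj₂ (proj₁ dz) refl

        escapes-unless-cut : (∀ {w} → S w ⊎ v ≡ w → c ≢ w) → ⊥
        escapes-unless-cut avoids =
          proj₂ (proj₂ trapped) (inj₂ (reach-map into (reaches-v (D⊆S trapped))))
          where
          into : Attach S u v ∖ ｛ u ｝ ⊆ₚ Attach S′ z v ∖ ｛ c ｝
          into (inj₁ sw , _) = S⊆Attach′ sw , avoids (inj₁ sw)
          into (inj₂ (inj₁ u≡w) , u≢w) = ⊥-elim (u≢w u≡w)
          into (inj₂ (inj₂ v≡w) , _) = inj₂ (inj₂ v≡w) , avoids (inj₂ v≡w)

        c≢u : c ≢ u
        c≢u refl = escapes-unless-cut λ { (inj₁ sw) refl → u∉S sw
                                        ; (inj₂ v≡u) refl → u≢v (≡.sym v≡u) }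

        c-in-lobe : S c ⊎ v ≡ c
        c-in-lobe with S? c | v ≟ c
        ... | yes sc | _ = inj₁ sc
        ... | no _ | yes v≡c = inj₂ v≡c
        ... | no ¬sc | no v≢c = ⊥-elim (escapes-unless-cut λ { (inj₁ sw) refl → ¬sc sw
                                                               ; (inj₂ v≡w) refl → v≢c v≡w })

        D-closed : D y → Adj G y w → (Attach S′ z v ∖ ｛ c ｝) w → D w
        D-closed {y = y} {w = w} (s′y , c≢y , ¬esc) yw (inj₁ s′w , c≢w) =
          s′w , c≢w , ¬esc ∘ escape-via-w
          where
          escape-via-w : Escapes c w → Escapes c y
          escape-via-w = Sum.map (λ (_ , walk , ps) → _ , step yw walk , (inj₁ s′y , c≢y) ∷ ps)
                                 (λ (_ , walk , ps) → _ , step yw walk , (inj₁ s′y , c≢y) ∷ ps)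
        D-closed (s′y , c≢y , ¬esc) yw aw@(inj₂ (inj₁ refl) , _) =
          ⊥-elim (¬esc (inj₁ (_ , step yw here , (inj₁ s′y , c≢y) ∷ aw ∷ [])))
        D-closed (s′y , c≢y , ¬esc) yw aw@(inj₂ (inj₂ refl) , _) =
          ⊥-elim (¬esc (inj₂ (_ , step yw here , (inj₁ s′y , c≢y) ∷ aw ∷ [])))

        D-neighbours : D y → Adj G y w → Attach S u v w → Attach D u c w
        D-neighbours {w = w} dy yw aw with c ≟ w
        ... | yes c≡w = inj₂ (inj₂ c≡w)
        D-neighbours dy yw (inj₁ sw) | no c≢w = inj₁ (D-closed dy yw (S⊆Attach′ sw , c≢w))
        D-neighbours dy yw (inj₂ (inj₁ u≡w)) | no _ = inj₂ (inj₁ u≡w)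
        D-neighbours dy yw (inj₂ (inj₂ v≡w)) | no c≢w = inj₁ (D-closed dy yw (inj₂ (inj₂ v≡w) , c≢w))

        D-linked : Linked D u c
        D-linked {c = c′} {x = x′} dx′ c′≢x′ =
          Sum.map (reach-map trim) (reach-map trim)
            (Sum.[ exit (u∉S ∘ D⊆S) , exit (v∉S ∘ D⊆S) ]′ (linked (D⊆S dx′) c′≢x′))
          where
          boundary : D y → Adj G y w → (Attach S u v ∖ ｛ c′ ｝) w → ¬ D w → u ≡ w ⊎ c ≡ w
          boundary dy yw (aw , _) ¬dw = Sum.[ ⊥-elim ∘ ¬dw , id ] (D-neighbours dy yw aw)

          Within : Pred V 0ℓ
          Within = Attach D u c ∩ (Attach S u v ∖ ｛ c′ ｝)

          exit : ¬ D y → Reach (Attach S u v ∖ ｛ c′ ｝) x′ y → Reach Within x′ u ⊎ Reach Within x′ c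
          exit = reach-boundary (trapped? c) boundary dx′

          trim : Within ⊆ₚ Attach D u c ∖ ｛ c′ ｝
          trim (aw , _ , c′≢w) = aw , c′≢w

        D-lobe : Lobe (trapped? c) u c δ
        D-lobe = record
          { u≢v = c≢u ∘ ≡.sym ; u∉S = u∉S ∘ D⊆S ; v∉S = λ dc → proj₁ (proj₂ dc) refl
          ; inhabited = x , trapped
          ; min-degree = λ {y} dy → ≤-trans (min-degree (D⊆S dy))
              (count-mono _ (Adj? y ∩? attach? (trapped? c) u c)
                          (λ (yw , aw) → yw , D-neighbours dy yw aw) vertices)
          ; linked = D-linked }

        path-from-c : S c → ∃ λ ys → Path G c v (c ∷ ys) × All ((Attach S u v ∖ ｛ u ｝) ∩ ∁ D) ys
        path-from-c sc with reaches-v sc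
        ... | _ , walk , ps with walk⇒path walk ps
        ...   | _ , (here , _) , _ = ⊥-elim (v∉S sc)
        ...   | _ ∷ ys , (step cb walk′ , c∉ys ∷ uq) , _ ∷ qs =
                ys , (step cb walk′ , c∉ys ∷ uq) ,
                All.zip (qs , walk-avoids closed walk′ (All.zip (qs , c∉ys)) (v∉S ∘ D⊆S))
          where
          closed : D y → Adj G y w → ((Attach S u v ∖ ｛ u ｝) ∩ (c ≢_)) w → D w
          closed dy yw ((aw , u≢w) , c≢w) with D-neighbours dy yw aw
          ... | inj₁ dw = dw
          ... | inj₂ (inj₁ u≡w) = ⊥-elim (u≢w u≡w)
          ... | inj₂ (inj₂ c≡w) = ⊥-elim (c≢w c≡w)

        long-path : LongPath S u v δ
        long-path with ih size-D D-lobe | c-in-lobe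
        ... | xs , path , len , ps | inj₂ refl =
              xs , path , len ,
              All.map (attach-⊆ {S = D} (inj₁ ∘ D⊆S) (inj₂ (inj₁ refl)) (inj₂ (inj₂ refl))) ps
        ... | xs , path , len , ps | inj₁ sc with path-from-c sc
        ...   | ys , path′@(_ , c∉ys ∷ _) , qs =
                xs ++ ys , path-++ path path′ disjoint , ≤-trans len (length-++-≤ˡ xs) ,
                All.++⁺ (All.map (attach-⊆ {S = D} (inj₁ ∘ D⊆S) (inj₂ (inj₁ refl)) (inj₁ sc)) ps)
                        (All.map (proj₁ ∘ proj₁) qs)
          where
          disjoint : w List.∈ xs → w List.∈ ys → ⊥
          disjoint w∈xs w∈ys with All.lookup ps w∈xs | All.lookup qs w∈ys | All.lookup c∉ys w∈ys
          ... | inj₁ dw | _ , ¬dw | _ = ¬dw dw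
          ... | inj₂ (inj₁ u≡w) | (_ , u≢w) , _ | _ = u≢w u≡w
          ... | inj₂ (inj₂ c≡w) | _ | c≢w = c≢w c≡w

      long-path : LongPath S u v δ
      long-path with any? S′?
      ... | no ∄S′ = path-through-z only-z
        where
        only-z : S w → z ≡ w
        only-z {w = w} sw with z ≟ w
        ... | yes z≡w = z≡w
        ... | no z≢w = ⊥-elim (∄S′ (w , sw , z≢w))
      ... | yes inhabited′ with linked-or-trapped
      ...   | inj₁ linked′ = extend (ih size′ (shifted-lobe inhabited′ linked′))
      ...   | inj₂ (_ , _ , trapped) = Cut.long-path trapped

    long-path : LongPath S u v δ
    long-path = let _ , sz , uz = neighbour-of-u in Peel.long-path sz uz

  lobe-long-path′ : ∀ k {S? : Decidable P} → count S? vertices ≤ k → Lobe S? a b δ → LongPath P a b δ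
  lobe-long-path′ zero {S?} size L with Lobe.inhabited L
  ... | x , sx with ≤-trans (filter-some S? (Any.map (λ { refl → sx }) (∈-allFin x))) size
  ...   | ()
  lobe-long-path′ (suc k) {S?} size L = InductionStep.long-path k (lobe-long-path′ k) S? size L

  lobe-long-path : {S? : Decidable P} → Lobe S? a b δ → LongPath P a b δ
  lobe-long-path {S? = S?} = lobe-long-path′ (count S? vertices) ≤-refl

module Separation (G : Graph) (2-connected : TwoConnected G) {u v : Fin (n G)} (u≢v : u ≢ v)
    (V₁ V₂ : Subset (n G)) (u∉V₂ : u ∉ V₂) (v∉V₂ : v ∉ V₂)
    (cover : ∀ w → w ≢ u → w ≢ v → w ∈ V₁ ⊎ w ∈ V₂)
    (no-edge : ∀ x y → x ∈ V₁ → y ∈ V₂ → ¬ Adj G x y) where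

  V₂-neighbours : ∀ {x y} → x ∈ V₂ → Adj G x y → Attach G (_∈ V₂) u v y
  V₂-neighbours {x} {y} x∈V₂ xy with u ≟ y | v ≟ y
  ... | yes u≡y | _ = inj₂ (inj₁ u≡y)
  ... | no _ | yes v≡y = inj₂ (inj₂ v≡y)
  ... | no u≢y | no v≢y with cover y (u≢y ∘ ≡.sym) (v≢y ∘ ≡.sym)
  ...   | inj₁ y∈V₁ = ⊥-elim (no-edge y x y∈V₁ x∈V₂ (Adj-sym G xy))
  ...   | inj₂ y∈V₂ = inj₁ y∈V₂

  V₂-degree : ∀ {x} → x ∈ V₂ → degree G x ≤ degreeIn G (attach? G (_∈? V₂) u v) x
  V₂-degree {x} x∈V₂ = count-mono (λ y → T? (adj G x y)) (Adj? G x ∩? attach? G (_∈? V₂) u v)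
    (λ t → let xy = Equivalence.to T-≡ t in xy , V₂-neighbours x∈V₂ xy) (allFin (n G))

  V₂-escape : ∀ {c x t} → x ∈ V₂ → c ≢ x → t ∉ V₂ → t ≢ c →
              Reach G (Attach G (_∈ V₂) u v ∖ ｛ c ｝) x u ⊎
              Reach G (Attach G (_∈ V₂) u v ∖ ｛ c ｝) x v
  V₂-escape {c} {x} {t} x∈V₂ c≢x t∉V₂ t≢c =
    Sum.map (reach-map G trim) (reach-map G trim)
      (reach-boundary G (_∈? V₂) boundary x∈V₂ t∉V₂ (proj₂ 2-connected c x t (c≢x ∘ ≡.sym) t≢c))
    where
    boundary : ∀ {d e} → d ∈ V₂ → Adj G d e → e ≢ c → e ∉ V₂ → u ≡ e ⊎ v ≡ e
    boundary d∈V₂ de _ e∉V₂ = Sum.[ ⊥-elim ∘ e∉V₂ , id ]′ (V₂-neighbours d∈V₂ de)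

    trim : Attach G (_∈ V₂) u v ∩ (_≢ c) ⊆ₚ Attach G (_∈ V₂) u v ∖ ｛ c ｝
    trim (aw , w≢c) = aw , w≢c ∘ ≡.sym

  V₂-linked : Linked G (_∈ V₂) u v
  V₂-linked {c} x∈V₂ c≢x with c ≟ u
  ... | yes refl = V₂-escape x∈V₂ c≢x v∉V₂ (u≢v ∘ ≡.sym)
  ... | no c≢u = V₂-escape x∈V₂ c≢x u∉V₂ (c≢u ∘ ≡.sym)

lemma2 : (G : Graph) → TwoConnected G →
    (u v : Fin (n G)) → u ≢ v →
    (V₁ V₂ : Subset (n G)) →
    u ∉ V₁ → v ∉ V₁ → u ∉ V₂ → v ∉ V₂ →
    (∀ w → w ∈ V₁ → w ∉ V₂) →
    (∀ w → w ≢ u → w ≢ v → w ∈ V₁ ⊎ w ∈ V₂) →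
    (∃ λ w → w ∈ V₁) → (∃ λ w → w ∈ V₂) →
    (∀ x y → x ∈ V₁ → y ∈ V₂ → ¬ Adj G x y) →
    (δ : ℕ) → (∀ w → w ≢ u → w ≢ v → δ ≤ degree G w) →
    ∃ λ xs → Path G u v xs × suc δ ≤ length xs × All (λ x → x ∉ V₁) xs
lemma2 G 2-connected u v u≢v V₁ V₂ u∉V₁ v∉V₁ u∉V₂ v∉V₂ disjoint cover _ V₂-inhabited no-edge δ degree≥δ =
  let xs , path , long , inside = lobe-long-path G V₂-lobe
  in xs , path , long , All.map outside-V₁ inside
  where
  open Separation G 2-connected u≢v V₁ V₂ u∉V₂ v∉V₂ cover no-edge

  V₂-lobe : Lobe G (_∈? V₂) u v δ
  V₂-lobe = record
    { u≢v = u≢v ; u∉S = u∉V₂ ; v∉S = v∉V₂ ; inhabited = V₂-inhabited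
    ; min-degree = λ {x} x∈V₂ →
        ≤-trans (degree≥δ x (λ { refl → u∉V₂ x∈V₂ }) (λ { refl → v∉V₂ x∈V₂ })) (V₂-degree x∈V₂)
    ; linked = V₂-linked }

  outside-V₁ : ∀ {w} → Attach G (_∈ V₂) u v w → w ∉ V₁
  outside-V₁ (inj₁ w∈V₂) w∈V₁ = disjoint _ w∈V₁ w∈V₂
  outside-V₁ (inj₂ (inj₁ refl)) = u∉V₁
  outside-V₁ (inj₂ (inj₂ refl)) = v∉V₁
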